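{- Let $n\ge 1$, $i\in\{1,\dots,n-1\}$, and let $C$ be an $s_i$-stable set of transpositions in $S_n$ (i.e. $s_i\in C$ and $s_iCs_i=C$). Then $\partial_i$ maps $H_C$ into $H_C$, and both the kernel and the image of $\partial_i:H_C\to H_C$ are equal to $H_C^{*s_i}=\{f\in H_C\mid f*s_i=f\}$.
   Context: Permutations compose as functions: $(vw)(j)=v(w(j))$. $s_i=(i\leftrightarrow i+1)$. Let $H=\operatorname{Fun}(S_n,\mathbb{C}[t_1,\dots,t_n])$ with pointwise operations. The star action is the right action $(f*w)(v)=f(vw^{ -1})$, extended linearly to the group algebra. In $H$, $t_j$ denotes the constant function $v\mapsto t_j$ and $x_j$ the function $v\mapsto t_{v(j)}$. For a transposition $\tau=(j\leftrightarrow k)$, $f\in H$ satisfies condition $\tau$ if $f-f*\tau=(x_j-x_k)g$ for some $g\in H$; these $f$ form a subring $H_\tau$, and for a set $C$ of transpositions $H_C=\bigcap_{\tau\in C}H_\tau$. For $f\in H_{s_i}$, the divided difference $\partial_i(f)$ is the unique $g\in H$ with $f-f*s_i=(x_i-x_{i+1})g$. -}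

module Defs where

open import Level using (Level; _⊔_) renaming (suc to lsuc)
open import Algebra.Bundles using (CommutativeRing)
open import Data.Nat as ℕ using (ℕ; zero; suc)
open import Data.Fin using (Fin; inject₁) renaming (_≟_ to _≟F_)
open import Data.Vec using (Vec; lookup; tabulate; replicate; zipWith)
import Data.Vec as V
open import Data.Vec.Properties using (≡-dec)
open import Data.List using (List; []; _∷_; _++_; map; concatMap)
open import Data.Product using (Σ; _×_; _,_; proj₁; proj₂)
open import Data.Bool using (if_then_else_)
open import Relation.Nullary using (¬_; does)
open import Relation.Binary.PropositionalEquality using (_≡_)
open import Function.Definitions using (Injective)

natMul : ∀ {c ℓ} (R : CommutativeRing c ℓ) → ℕ → CommutativeRing.Carrier R
natMul R zero    = CommutativeRing.0# R
natMul R (suc n) = CommutativeRing._+_ R (CommutativeRing.1# R) (natMul R n)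

-- Fields of characteristic zero (the stdlib has no Field bundle and
-- no complex numbers; ℂ is replaced by an arbitrary such field K).

record Field c ℓ : Set (lsuc (c ⊔ ℓ)) where
  field
    commRing : CommutativeRing c ℓ
  open CommutativeRing commRing public
  field
    0≉1      : ¬ (0# ≈ 1#)
    inverse  : ∀ x → ¬ (x ≈ 0#) → Σ Carrier (λ y → (x * y) ≈ 1#)
    char-0   : ∀ n → ¬ (natMul commRing (suc n) ≈ 0#)

swapFin : ∀ {n} → Fin n → Fin n → Fin n → Fin n
swapFin j k l =
  if does (l ≟F j) then k else (if does (l ≟F k) then j else l)

-- Permutations of {0,…,n-1} as tables: v is the table of the map
-- j ↦ lookup v j.  Tables of permutations are compared with _≡_.

Table : ℕ → Set
Table n = Vec (Fin n) n

_∘T_ : ∀ {n} → Table n → Table n → Table n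
v ∘T w = V.map (lookup v) w

IsPerm : ∀ {n} → Table n → Set
IsPerm v = Injective _≡_ _≡_ (lookup v)

transpT : ∀ {n} → Fin n → Fin n → Table n
transpT j k = tabulate (swapFin j k)

module WithField {c ℓ} (K : Field c ℓ) where

  open Field K

  -- Polynomials K[t_1,…,t_n]: finite lists of terms (coefficient,
  -- exponent vector); two lists are equal iff all coefficients agree.

  Mono : ℕ → Set
  Mono n = Vec ℕ n

  Poly : ℕ → Set c
  Poly n = List (Carrier × Mono n)

  coeff : ∀ {n} → Poly n → Mono n → Carrier
  coeff []             m = 0#
  coeff ((a , e) ∷ p) m =
    if does (≡-dec ℕ._≟_ e m) then a + coeff p m else coeff p m

  infix 4 _≈P_
  _≈P_ : ∀ {n} → Poly n → Poly n → Set ℓ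
  p ≈P q = ∀ m → coeff p m ≈ coeff q m

  0P : ∀ {n} → Poly n
  0P = []

  _+P_ : ∀ {n} → Poly n → Poly n → Poly n
  p +P q = p ++ q

  -P_ : ∀ {n} → Poly n → Poly n
  -P p = map (λ { (a , e) → (- a , e) }) p

  _-P_ : ∀ {n} → Poly n → Poly n → Poly n
  p -P q = p +P (-P q)

  _*P_ : ∀ {n} → Poly n → Poly n → Poly n
  p *P q = concatMap (λ { (a , e) → map (λ { (b , e′) → (a * b , zipWith ℕ._+_ e e′) }) q }) p

  var : ∀ {n} → Fin n → Poly n
  var {n} j = (1# , tabulate (λ k → if does (k ≟F j) then 1 else 0)) ∷ []

  -- H = Fun(S_n, K[t]) with pointwise operations.  An element is a map
  -- on tables; only its values on permutation tables matter.

  H : ℕ → Set c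
  H n = Table n → Poly n

  infix 4 _≈H_
  _≈H_ : ∀ {n} → H n → H n → Set ℓ
  f ≈H g = ∀ v → IsPerm v → f v ≈P g v

  0H : ∀ {n} → H n
  0H v = 0P

  _-H_ : ∀ {n} → H n → H n → H n
  (f -H g) v = f v -P g v

  _*H_ : ∀ {n} → H n → H n → H n
  (f *H g) v = f v *P g v

  x : ∀ {n} → Fin n → H n
  x j v = var (lookup v j)

  -- star action by the transposition τ = (j ↔ k):
  -- (f * τ)(v) = f(v τ⁻¹) = f(v τ)   (τ⁻¹ = τ)
  _⋆[_,_] : ∀ {n} → H n → Fin n → Fin n → H n
  (f ⋆[ j , k ]) v = f (v ∘T transpT j k)

  Cond : ∀ {n} → Fin n → Fin n → H n → Set (c ⊔ ℓ)
  Cond j k f = Σ (H _) (λ g → (f -H (f ⋆[ j , k ])) ≈H ((x j -H x k) *H g))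

  -- f ∈ H_C, for C a set of transpositions given as a relation on pairs
  InH : ∀ {n} → (Fin n → Fin n → Set) → H n → Set (c ⊔ ℓ)
  InH C f = ∀ j k → C j k → Cond j k f

  -- s_i = (i ↔ i+1) in S_{m+1}, i : Fin m  (0-based positions)
  Cond-s : ∀ {m} → Fin m → H (suc m) → Set (c ⊔ ℓ)
  Cond-s i = Cond (inject₁ i) (Fin.suc i)

  -- divided difference ∂_i f for f ∈ H_{s_i}: the g witnessing the
  -- condition (unique, since x_i - x_{i+1} is a non-zero-divisor)
  ∂ : ∀ {m} (i : Fin m) (f : H (suc m)) → Cond-s i f → H (suc m)
  ∂ i f c = proj₁ c

{-# OPTIONS --safe #-}
module Submission where

-- Write s = (a b) and, for a permutation v, A = v a and B = v b.  The divided difference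
-- g = ∂f is characterised coefficientwise by f v - f (v s) = (t_A - t_B) g v, and t_A - t_B
-- is a non-zero-divisor in K[t]; so g is unique, s-invariant, and zero exactly when f is
-- s-invariant.  Conversely, an s-invariant g ∈ H_C is ∂(x_a g), as every H_τ is closed
-- under multiplication by x_a.  For τ = (j k) ∈ C, comparing f at v, v s, v τ and v τ s
-- (when τ meets s, using also the condition for s τ s ∈ C) shows that t_J - t_K divides
-- (t_A - t_B)(g v - g (v τ)).  The two linear forms being coprime, t_J - t_K divides
-- g v - g (v τ): dividing with remainder by t_J - t_K leaves a remainder free of t_J,
-- and a multiple of t_J - t_K free of t_J is zero.

open import Defs
open import Algebra.Bundles using (CommutativeRing; RawRing)
import Algebra.Solver.Ring
import Algebra.Solver.Ring.AlmostCommutativeRing as ACR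
import Algebra.Properties.Semiring.Mult as SemiringMult
import Algebra.Properties.Ring as RingProperties
import Algebra.Properties.Group as GroupProperties
import Algebra.Properties.AbelianGroup as AbelianGroupProperties
import Algebra.Properties.CommutativeSemigroup as CommutativeSemigroupProperties
import Relation.Binary.Reasoning.Setoid as SetoidReasoning
open import Data.Bool using (if_then_else_)
open import Data.Empty using (⊥-elim)
open import Data.Fin using (Fin; inject₁)
open import Data.Fin.Properties using (_≟_)
open import Data.List as List using ([]; _∷_; _++_)
import Data.List.Properties as ListProperties
open import Data.Maybe using (Maybe; just; nothing)
open import Data.Nat as ℕ using (ℕ; zero; suc)
open import Data.Nat.Properties using (1+n≢0)
open import Data.Product using (Σ; _×_; _,_; proj₁; proj₂)
open import Data.Vec using (Vec; lookup; tabulate; updateAt; zipWith)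
import Data.Vec.Properties as VP
open import Data.Vec.Properties using (≡-dec)
open import Data.Vec.Relation.Binary.Pointwise.Extensional using (ext; Pointwise-≡⇒≡)
open import Function using (_∘_)
open import Function.Bundles using (_⇔_; mk⇔; Equivalence)
open import Function.Definitions using (Injective)
open import Relation.Nullary using (¬_; yes; no; does)
open import Relation.Nullary.Decidable using (dec-true; dec-false)
open import Relation.Binary.PropositionalEquality as ≡ using (_≡_; _≢_; refl; cong)

module CommutativeRingSolver {c ℓ} (R : CommutativeRing c ℓ) where
  open CommutativeRing R renaming (refl to ≈-refl; sym to ≈-sym; trans to ≈-trans)
  open SemiringMult semiring using (×-homo-+; ×1-homo-*) renaming (_×_ to _·_)
  open RingProperties ring using (-‿distribˡ-*; -‿distribʳ-*; -‿involutive)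
  open AbelianGroupProperties +-abelianGroup using (⁻¹-∙-comm; ⁻¹-anti-homo‿-)
  open CommutativeSemigroupProperties +-commutativeSemigroup using (interchange)
  open SetoidReasoning setoid

  -- Integer coefficients as formal differences (a , b) ↦ a - b, so that the
  -- solver can detect cancelling coefficients in an arbitrary commutative ring.
  ℕ²-rawRing : RawRing _ _
  ℕ²-rawRing = record
    { Carrier = ℕ × ℕ ; _≈_ = _≡_
    ; _+_ = λ { (a , b) (c , d) → (a ℕ.+ c , b ℕ.+ d) }
    ; _*_ = λ { (a , b) (c , d) → (a ℕ.* c ℕ.+ b ℕ.* d , a ℕ.* d ℕ.+ b ℕ.* c) }
    ; -_ = λ { (a , b) → (b , a) }
    ; 0# = (0 , 0) ; 1# = (1 , 0) }

  ⟦_⟧ℤ : ℕ × ℕ → Carrier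
  ⟦ a , b ⟧ℤ = a · 1# - b · 1#

  difference-of-sums : ∀ a b c d → (a + c) - (b + d) ≈ (a - b) + (c - d)
  difference-of-sums a b c d = begin
    (a + c) - (b + d)     ≈⟨ +-congˡ (⁻¹-∙-comm b d) ⟨
    (a + c) + (- b + - d) ≈⟨ interchange a c (- b) (- d) ⟩
    (a - b) + (c - d)     ∎

  -x*-y≈x*y : ∀ x y → - x * - y ≈ x * y
  -x*-y≈x*y x y = begin
    - x * - y     ≈⟨ -‿distribˡ-* x (- y) ⟨
    - (x * - y)   ≈⟨ -‿cong (-‿distribʳ-* x y) ⟨
    - - (x * y)   ≈⟨ -‿involutive _ ⟩
    x * y         ∎

  product-of-differences : ∀ a b c d → (a - b) * (c - d) ≈ (a * c + b * d) - (a * d + b * c)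
  product-of-differences a b c d = begin
    (a - b) * (c - d)                           ≈⟨ distribʳ _ _ _ ⟩
    a * (c - d) + - b * (c - d)                 ≈⟨ +-cong (distribˡ _ _ _) (distribˡ _ _ _) ⟩
    (a * c + a * - d) + (- b * c + - b * - d)   ≈⟨ +-cong (+-congˡ (≈-sym (-‿distribʳ-* a d))) (+-cong (≈-sym (-‿distribˡ-* b c)) (-x*-y≈x*y b d)) ⟩
    (a * c - a * d) + (- (b * c) + b * d)       ≈⟨ +-congˡ (+-comm _ _) ⟩
    (a * c - a * d) + (b * d - b * c)           ≈⟨ difference-of-sums _ _ _ _ ⟨
    (a * c + b * d) - (a * d + b * c)           ∎

  ⟦⟧ℤ-homomorphism : ℕ²-rawRing ACR.-Raw-AlmostCommutative⟶ ACR.fromCommutativeRing R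
  ⟦⟧ℤ-homomorphism = record
    { ⟦_⟧ = ⟦_⟧ℤ
    ; +-homo = λ { (a , b) (c , d) → ≈-trans (+-cong (×-homo-+ 1# a c) (-‿cong (×-homo-+ 1# b d))) (difference-of-sums _ _ _ _) }
    ; *-homo = λ { (a , b) (c , d) → ≈-trans
                     (+-cong (≈-trans (×-homo-+ 1# (a ℕ.* c) (b ℕ.* d)) (+-cong (×1-homo-* a c) (×1-homo-* b d)))
                             (-‿cong (≈-trans (×-homo-+ 1# (a ℕ.* d) (b ℕ.* c)) (+-cong (×1-homo-* a d) (×1-homo-* b c)))))
                     (≈-sym (product-of-differences _ _ _ _)) }
    ; -‿homo = λ { (a , b) → ≈-sym (⁻¹-anti-homo‿- _ _) }
    ; 0-homo = -‿inverseʳ 0#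
    ; 1-homo = ≈-trans (+-assoc _ _ _) (≈-trans (+-congˡ (-‿inverseʳ 0#)) (+-identityʳ _)) }

  difference-≈-cross : ∀ x y z w → x + w ≈ y + z → x - y ≈ z - w
  difference-≈-cross x y z w e = begin
    x - y                  ≈⟨ +-identityʳ _ ⟨
    (x - y) + 0#           ≈⟨ +-congˡ (-‿inverseʳ w) ⟨
    (x - y) + (w - w)      ≈⟨ difference-of-sums x y w w ⟨
    (x + w) - (y + w)      ≈⟨ +-cong e ≈-refl ⟩
    (y + z) - (y + w)      ≈⟨ difference-of-sums y y z w ⟩
    (y - y) + (z - w)      ≈⟨ +-congʳ (-‿inverseʳ y) ⟩
    0# + (z - w)           ≈⟨ +-identityˡ _ ⟩
    z - w                  ∎

  ⟦⟧ℤ-≈? : ∀ p q → Maybe (⟦ p ⟧ℤ ≈ ⟦ q ⟧ℤ)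
  ⟦⟧ℤ-≈? (a , b) (c , d) with a ℕ.+ d ℕ.≟ b ℕ.+ c
  ... | yes e = just (difference-≈-cross _ _ _ _
                       (≈-trans (≈-sym (×-homo-+ 1# a d)) (≈-trans (reflexive (cong (_· 1#) e)) (×-homo-+ 1# b c))))
  ... | no _  = nothing

  open Algebra.Solver.Ring ℕ²-rawRing (ACR.fromCommutativeRing R) ⟦⟧ℤ-homomorphism ⟦⟧ℤ-≈? public
    using (solve; _:+_; _:-_; :-_; _:=_)

module _ {n : ℕ} where

  data SwapFinView (j k l : Fin n) : Set where
    at-j  : l ≡ j → SwapFinView j k l
    at-k  : l ≢ j → l ≡ k → SwapFinView j k l
    fixed : l ≢ j → l ≢ k → SwapFinView j k l

  swapFinView : ∀ j k l → SwapFinView j k l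
  swapFinView j k l with l ≟ j | l ≟ k
  ... | yes l≡j | _       = at-j l≡j
  ... | no l≢j  | yes l≡k = at-k l≢j l≡k
  ... | no l≢j  | no l≢k  = fixed l≢j l≢k

  swapFin-j : ∀ j k → swapFin {n} j k j ≡ k
  swapFin-j j k rewrite dec-true (j ≟ j) refl = refl

  swapFin-k : ∀ j k → swapFin {n} j k k ≡ j
  swapFin-k j k with k ≟ j
  ... | yes k≡j = k≡j
  ... | no _ rewrite dec-true (k ≟ k) refl = refl

  swapFin-fixed : ∀ {j k l} → l ≢ j → l ≢ k → swapFin {n} j k l ≡ l
  swapFin-fixed {j} {k} {l} l≢j l≢k rewrite dec-false (l ≟ j) l≢j | dec-false (l ≟ k) l≢k = refl

  swapFin-involutive : ∀ j k l → swapFin j k (swapFin {n} j k l) ≡ l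
  swapFin-involutive j k l with swapFinView j k l
  ... | at-j refl     = ≡.trans (cong (swapFin l k) (swapFin-j l k)) (swapFin-k l k)
  ... | at-k _ refl   = ≡.trans (cong (swapFin j l) (swapFin-k j l)) (swapFin-j j l)
  ... | fixed l≢j l≢k = ≡.trans (cong (swapFin j k) (swapFin-fixed l≢j l≢k)) (swapFin-fixed l≢j l≢k)

  swapFin-comm : ∀ j k l → swapFin {n} j k l ≡ swapFin k j l
  swapFin-comm j k l with swapFinView j k l
  ... | at-j refl     = ≡.trans (swapFin-j l k) (≡.sym (swapFin-k k l))
  ... | at-k _ refl   = ≡.trans (swapFin-k j l) (≡.sym (swapFin-j l j))
  ... | fixed l≢j l≢k = ≡.trans (swapFin-fixed l≢j l≢k) (≡.sym (swapFin-fixed l≢k l≢j))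

  swapFin-injective : ∀ j k → Injective _≡_ _≡_ (swapFin {n} j k)
  swapFin-injective j k {x} {y} e =
    ≡.trans (≡.sym (swapFin-involutive j k x)) (≡.trans (cong (swapFin j k) e) (swapFin-involutive j k y))

  swapFin-conjugate : ∀ {σ : Fin n → Fin n} → Injective _≡_ _≡_ σ → ∀ j k l →
                      σ (swapFin j k l) ≡ swapFin (σ j) (σ k) (σ l)
  swapFin-conjugate {σ} σ-inj j k l with swapFinView j k l
  ... | at-j refl     = ≡.trans (cong σ (swapFin-j j k)) (≡.sym (swapFin-j (σ j) (σ k)))
  ... | at-k _ refl   = ≡.trans (cong σ (swapFin-k j k)) (≡.sym (swapFin-k (σ j) (σ k)))
  ... | fixed l≢j l≢k = ≡.trans (cong σ (swapFin-fixed l≢j l≢k))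
                                (≡.sym (swapFin-fixed (λ e → l≢j (σ-inj e)) (λ e → l≢k (σ-inj e))))

lookup-ext : ∀ {A : Set} {n} {xs ys : Vec A n} → (∀ i → lookup xs i ≡ lookup ys i) → xs ≡ ys
lookup-ext h = Pointwise-≡⇒≡ (ext h)

module _ {n : ℕ} where

  lookup-∘transpT : ∀ (v : Table n) j k l → lookup (v ∘T transpT j k) l ≡ lookup v (swapFin j k l)
  lookup-∘transpT v j k l =
    ≡.trans (VP.lookup-map l (lookup v) (transpT j k)) (cong (lookup v) (VP.lookup∘tabulate (swapFin j k) l))

  lookup-∘transpT-j : ∀ (v : Table n) j k → lookup (v ∘T transpT j k) j ≡ lookup v k
  lookup-∘transpT-j v j k = ≡.trans (lookup-∘transpT v j k j) (cong (lookup v) (swapFin-j j k))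

  lookup-∘transpT-k : ∀ (v : Table n) j k → lookup (v ∘T transpT j k) k ≡ lookup v j
  lookup-∘transpT-k v j k = ≡.trans (lookup-∘transpT v j k k) (cong (lookup v) (swapFin-k j k))

  lookup-∘transpT-fixed : ∀ (v : Table n) {j k l} → l ≢ j → l ≢ k → lookup (v ∘T transpT j k) l ≡ lookup v l
  lookup-∘transpT-fixed v {j} {k} {l} l≢j l≢k =
    ≡.trans (lookup-∘transpT v j k l) (cong (lookup v) (swapFin-fixed l≢j l≢k))

  IsPerm-≢ : ∀ (v : Table n) → IsPerm v → ∀ {j k} → j ≢ k → lookup v j ≢ lookup v k
  IsPerm-≢ v v-perm j≢k e = j≢k (v-perm e)

  IsPerm-∘transpT : ∀ (v : Table n) j k → IsPerm v → IsPerm (v ∘T transpT j k)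
  IsPerm-∘transpT v j k v-inj {x} {y} e = swapFin-injective j k
    (v-inj (≡.trans (≡.sym (lookup-∘transpT v j k x)) (≡.trans e (lookup-∘transpT v j k y))))

  ∘transpT-involutive : ∀ (v : Table n) j k → (v ∘T transpT j k) ∘T transpT j k ≡ v
  ∘transpT-involutive v j k = lookup-ext λ l → begin
    lookup ((v ∘T transpT j k) ∘T transpT j k) l ≡⟨ lookup-∘transpT (v ∘T transpT j k) j k l ⟩
    lookup (v ∘T transpT j k) (swapFin j k l)    ≡⟨ lookup-∘transpT v j k (swapFin j k l) ⟩
    lookup v (swapFin j k (swapFin j k l))       ≡⟨ cong (lookup v) (swapFin-involutive j k l) ⟩
    lookup v l                                   ∎
    where open ≡.≡-Reasoning

  ∘transpT-comm : ∀ (v : Table n) j k → v ∘T transpT j k ≡ v ∘T transpT k j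
  ∘transpT-comm v j k = lookup-ext λ l →
    ≡.trans (lookup-∘transpT v j k l) (≡.trans (cong (lookup v) (swapFin-comm j k l)) (≡.sym (lookup-∘transpT v k j l)))

  ∘transpT-conjugate : ∀ (v : Table n) a b j k →
    (v ∘T transpT a b) ∘T transpT j k ≡ (v ∘T transpT (swapFin a b j) (swapFin a b k)) ∘T transpT a b
  ∘transpT-conjugate v a b j k = lookup-ext λ l → begin
    lookup ((v ∘T transpT a b) ∘T transpT j k) l   ≡⟨ lookup-∘transpT (v ∘T transpT a b) j k l ⟩
    lookup (v ∘T transpT a b) (swapFin j k l)      ≡⟨ lookup-∘transpT v a b (swapFin j k l) ⟩
    lookup v (σ (swapFin j k l))                   ≡⟨ cong (lookup v) (swapFin-conjugate (swapFin-injective a b) j k l) ⟩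
    lookup v (swapFin (σ j) (σ k) (σ l))           ≡⟨ lookup-∘transpT v (σ j) (σ k) (σ l) ⟨
    lookup (v ∘T transpT (σ j) (σ k)) (σ l)        ≡⟨ lookup-∘transpT (v ∘T transpT (σ j) (σ k)) a b l ⟨
    lookup ((v ∘T transpT (σ j) (σ k)) ∘T transpT a b) l ∎
    where
    open ≡.≡-Reasoning
    σ = swapFin a b

  ∘transpT-comm-disjoint : ∀ (v : Table n) {a b j k} → j ≢ a → j ≢ b → k ≢ a → k ≢ b →
    (v ∘T transpT a b) ∘T transpT j k ≡ (v ∘T transpT j k) ∘T transpT a b
  ∘transpT-comm-disjoint v {a} {b} {j} {k} j≢a j≢b k≢a k≢b = ≡.trans (∘transpT-conjugate v a b j k)
    (≡.cong₂ (λ j′ k′ → (v ∘T transpT j′ k′) ∘T transpT a b) (swapFin-fixed j≢a j≢b) (swapFin-fixed k≢a k≢b))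

  ∘transpT-adjacent : ∀ (v : Table n) {p q k} → k ≢ p → k ≢ q →
    (v ∘T transpT p q) ∘T transpT k q ≡ (v ∘T transpT k p) ∘T transpT p q
  ∘transpT-adjacent v {p} {q} {k} k≢p k≢q = ≡.trans (∘transpT-conjugate v p q k q)
    (≡.cong₂ (λ k′ p′ → (v ∘T transpT k′ p′) ∘T transpT p q) (swapFin-fixed k≢p k≢q) (swapFin-k p q))

inc dec : ∀ {n} → Fin n → Vec ℕ n → Vec ℕ n
inc x m = updateAt m x suc
dec x m = updateAt m x ℕ.pred

module _ {n : ℕ} where

  lookup-inc : ∀ (x : Fin n) m → lookup (inc x m) x ≡ suc (lookup m x)
  lookup-inc x m = VP.lookup∘updateAt x m

  lookup-dec : ∀ (x : Fin n) m → lookup (dec x m) x ≡ ℕ.pred (lookup m x)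
  lookup-dec x m = VP.lookup∘updateAt x m

  lookup-inc-≢ : ∀ {x y : Fin n} → y ≢ x → ∀ m → lookup (inc x m) y ≡ lookup m y
  lookup-inc-≢ {x} {y} y≢x m = VP.lookup∘updateAt′ y x y≢x m

  lookup-dec-≢ : ∀ {x y : Fin n} → y ≢ x → ∀ m → lookup (dec x m) y ≡ lookup m y
  lookup-dec-≢ {x} {y} y≢x m = VP.lookup∘updateAt′ y x y≢x m

  dec-inc : ∀ (x : Fin n) m → dec x (inc x m) ≡ m
  dec-inc x m = ≡.trans (VP.updateAt-updateAt x m) (VP.updateAt-id x m)

  inc-dec : ∀ (x : Fin n) m {r} → lookup m x ≡ suc r → inc x (dec x m) ≡ m
  inc-dec x m m[x]≡1+r = ≡.trans (VP.updateAt-updateAt x m) (VP.updateAt-id-local x m suc-pred)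
    where
    suc-pred : suc (ℕ.pred (lookup m x)) ≡ lookup m x
    suc-pred rewrite m[x]≡1+r = refl

  dec-inc-comm : ∀ {x y : Fin n} → x ≢ y → ∀ m → dec x (inc y m) ≡ inc y (dec x m)
  dec-inc-comm {x} {y} x≢y m = VP.updateAt-commutes x y x≢y m

  dec-dec-comm : ∀ {x y : Fin n} → x ≢ y → ∀ m → dec x (dec y m) ≡ dec y (dec x m)
  dec-dec-comm {x} {y} x≢y m = VP.updateAt-commutes x y x≢y m

  zipWith-+-unitExponent : ∀ (x : Fin n) m →
    zipWith ℕ._+_ (tabulate (λ k → if does (k ≟ x) then 1 else 0)) m ≡ inc x m
  zipWith-+-unitExponent x m = lookup-ext λ y →
    ≡.trans (VP.lookup-zipWith ℕ._+_ y (tabulate δ) m) (entry y (cong (ℕ._+ lookup m y) (VP.lookup∘tabulate δ y)))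
    where
    δ : Fin n → ℕ
    δ k = if does (k ≟ x) then 1 else 0

    entry : ∀ y {a} → a ≡ (if does (y ≟ x) then 1 else 0) ℕ.+ lookup m y → a ≡ lookup (inc x m) y
    entry y e with y ≟ x
    ... | yes refl = ≡.trans e (≡.sym (lookup-inc y m))
    ... | no y≢x   = ≡.trans e (≡.sym (lookup-inc-≢ y≢x m))

module CoefficientCalculus {c ℓ} (R : CommutativeRing c ℓ) where
  open CommutativeRing R renaming (refl to ≈-refl; sym to ≈-sym; trans to ≈-trans)
  open GroupProperties +-group using (x∙y⁻¹≈ε⇒x≈y; ε⁻¹≈ε)
  open CommutativeRingSolver R
  open SetoidReasoning setoid

  -- A polynomial in t_0, …, t_(n-1) is represented by its coefficient function
  -- F : ℕⁿ → R; mulVar x multiplies by t_x, and FreeOf x F says that no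
  -- monomial of F is divisible by t_x.
  Coeffs : ℕ → Set c
  Coeffs n = Vec ℕ n → Carrier

  module _ {n : ℕ} where

    infix 4 _≐_
    infixl 6 _⊞_ _⊟_
    infix 8 ⊝_

    _≐_ : Coeffs n → Coeffs n → Set ℓ
    F ≐ G = ∀ m → F m ≈ G m

    _⊞_ _⊟_ : Coeffs n → Coeffs n → Coeffs n
    (F ⊞ G) m = F m + G m
    (F ⊟ G) m = F m - G m

    ⊝_ : Coeffs n → Coeffs n
    (⊝ F) m = - F m

    𝟘 : Coeffs n
    𝟘 _ = 0#

    whenPositive : ℕ → Carrier → Carrier
    whenPositive zero    _ = 0#
    whenPositive (suc _) a = a

    mulVar : Fin n → Coeffs n → Coeffs n
    mulVar x F m = whenPositive (lookup m x) (F (dec x m))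

    mulDiff : Fin n → Fin n → Coeffs n → Coeffs n
    mulDiff j k F = mulVar j F ⊟ mulVar k F

    FreeOf : Fin n → Coeffs n → Set ℓ
    FreeOf x F = ∀ m → F (inc x m) ≈ 0#

    whenPositive-cong : ∀ k {a b} → a ≈ b → whenPositive k a ≈ whenPositive k b
    whenPositive-cong zero    _   = ≈-refl
    whenPositive-cong (suc _) a≈b = a≈b

    whenPositive-+ : ∀ k a b → whenPositive k (a + b) ≈ whenPositive k a + whenPositive k b
    whenPositive-+ zero    _ _ = ≈-sym (+-identityˡ 0#)
    whenPositive-+ (suc _) _ _ = ≈-refl

    whenPositive-‿ : ∀ k a b → whenPositive k (a - b) ≈ whenPositive k a - whenPositive k b
    whenPositive-‿ zero    _ _ = ≈-sym (-‿inverseʳ 0#)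
    whenPositive-‿ (suc _) _ _ = ≈-refl

    whenPositive-0# : ∀ k → whenPositive k 0# ≡ 0#
    whenPositive-0# zero    = refl
    whenPositive-0# (suc _) = refl

    whenPositive-comm : ∀ k l a → whenPositive k (whenPositive l a) ≡ whenPositive l (whenPositive k a)
    whenPositive-comm zero    zero    _ = refl
    whenPositive-comm zero    (suc _) _ = refl
    whenPositive-comm (suc _) zero    _ = refl
    whenPositive-comm (suc _) (suc _) _ = refl

    mulVar-inc : ∀ x F m → mulVar x F (inc x m) ≡ F m
    mulVar-inc x F m = ≡.cong₂ whenPositive (lookup-inc x m) (cong F (dec-inc x m))

    mulVar-cong : ∀ x {F G} → F ≐ G → mulVar x F ≐ mulVar x G
    mulVar-cong x F≐G m = whenPositive-cong (lookup m x) (F≐G (dec x m))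

    mulVar-⊞ : ∀ x F G → mulVar x (F ⊞ G) ≐ mulVar x F ⊞ mulVar x G
    mulVar-⊞ x F G m = whenPositive-+ (lookup m x) _ _

    mulVar-⊟ : ∀ x F G → mulVar x (F ⊟ G) ≐ mulVar x F ⊟ mulVar x G
    mulVar-⊟ x F G m = whenPositive-‿ (lookup m x) _ _

    mulVar-⊝ : ∀ x F → mulVar x (⊝ F) ≐ ⊝ mulVar x F
    mulVar-⊝ x F m with lookup m x
    ... | zero  = ≈-sym ε⁻¹≈ε
    ... | suc _ = ≈-refl

    mulVar-𝟘 : ∀ x → mulVar x 𝟘 ≐ 𝟘
    mulVar-𝟘 x m = reflexive (whenPositive-0# (lookup m x))

    mulVar-comm : ∀ x y F → mulVar x (mulVar y F) ≐ mulVar y (mulVar x F)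
    mulVar-comm x y F m with x ≟ y
    ... | yes refl = ≈-refl
    ... | no x≢y   = begin
      whenPositive (lookup m x) (whenPositive (lookup (dec x m) y) (F (dec y (dec x m))))
        ≡⟨ ≡.cong₂ (λ k m′ → whenPositive (lookup m x) (whenPositive k (F m′)))
                   (lookup-dec-≢ (x≢y ∘ ≡.sym) m) (dec-dec-comm (x≢y ∘ ≡.sym) m) ⟩
      whenPositive (lookup m x) (whenPositive (lookup m y) (F (dec x (dec y m))))
        ≡⟨ whenPositive-comm (lookup m x) (lookup m y) _ ⟩
      whenPositive (lookup m y) (whenPositive (lookup m x) (F (dec x (dec y m))))
        ≡⟨ cong (λ k → whenPositive (lookup m y) (whenPositive k (F (dec x (dec y m))))) (lookup-dec-≢ x≢y m) ⟨
      whenPositive (lookup m y) (whenPositive (lookup (dec y m) x) (F (dec x (dec y m)))) ∎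

    mulVar-FreeOf : ∀ {x J} F → x ≢ J → FreeOf J F → FreeOf J (mulVar x F)
    mulVar-FreeOf {x} {J} F x≢J F-free m = begin
      whenPositive (lookup (inc J m) x) (F (dec x (inc J m))) ≈⟨ whenPositive-cong (lookup (inc J m) x) (reflexive (cong F (dec-inc-comm x≢J m))) ⟩
      whenPositive (lookup (inc J m) x) (F (inc J (dec x m))) ≈⟨ whenPositive-cong (lookup (inc J m) x) (F-free (dec x m)) ⟩
      whenPositive (lookup (inc J m) x) 0#                    ≡⟨ whenPositive-0# (lookup (inc J m) x) ⟩
      0#                                                      ∎

    mulVar-mulDiff-comm : ∀ x J K F → mulVar x (mulDiff J K F) ≐ mulDiff J K (mulVar x F)
    mulVar-mulDiff-comm x J K F m = begin
      mulVar x (mulVar J F ⊟ mulVar K F) m               ≈⟨ mulVar-⊟ x (mulVar J F) (mulVar K F) m ⟩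
      mulVar x (mulVar J F) m - mulVar x (mulVar K F) m  ≈⟨ +-cong (mulVar-comm x J F m) (-‿cong (mulVar-comm x K F m)) ⟩
      mulVar J (mulVar x F) m - mulVar K (mulVar x F) m  ∎

    mulDiff-cong : ∀ J K {F G} → F ≐ G → mulDiff J K F ≐ mulDiff J K G
    mulDiff-cong J K F≐G m = +-cong (mulVar-cong J F≐G m) (-‿cong (mulVar-cong K F≐G m))

    mulDiff-⊞ : ∀ J K F G → mulDiff J K (F ⊞ G) ≐ mulDiff J K F ⊞ mulDiff J K G
    mulDiff-⊞ J K F G m = begin
      mulVar J (F ⊞ G) m - mulVar K (F ⊞ G) m                              ≈⟨ +-cong (mulVar-⊞ J F G m) (-‿cong (mulVar-⊞ K F G m)) ⟩
      (mulVar J F m + mulVar J G m) - (mulVar K F m + mulVar K G m)      ≈⟨ solve 4 (λ a b c d → (a :+ b) :- (c :+ d) := (a :- c) :+ (b :- d)) ≈-refl _ _ _ _ ⟩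
      (mulVar J F m - mulVar K F m) + (mulVar J G m - mulVar K G m)      ∎

    mulDiff-⊟ : ∀ J K F G → mulDiff J K (F ⊟ G) ≐ mulDiff J K F ⊟ mulDiff J K G
    mulDiff-⊟ J K F G m = begin
      mulVar J (F ⊟ G) m - mulVar K (F ⊟ G) m                              ≈⟨ +-cong (mulVar-⊟ J F G m) (-‿cong (mulVar-⊟ K F G m)) ⟩
      (mulVar J F m - mulVar J G m) - (mulVar K F m - mulVar K G m)      ≈⟨ solve 4 (λ a b c d → (a :- b) :- (c :- d) := (a :- c) :- (b :- d)) ≈-refl _ _ _ _ ⟩
      (mulVar J F m - mulVar K F m) - (mulVar J G m - mulVar K G m)      ∎

    mulDiff-𝟘 : ∀ J K → mulDiff J K 𝟘 ≐ 𝟘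
    mulDiff-𝟘 J K m = ≈-trans (+-cong (mulVar-𝟘 J m) (-‿cong (mulVar-𝟘 K m))) (-‿inverseʳ 0#)

    mulDiff-comm : ∀ A B J K F → mulDiff A B (mulDiff J K F) ≐ mulDiff J K (mulDiff A B F)
    mulDiff-comm A B J K F m = begin
      mulVar A (mulDiff J K F) m - mulVar B (mulDiff J K F) m ≈⟨ +-cong (mulVar-mulDiff-comm A J K F m) (-‿cong (mulVar-mulDiff-comm B J K F m)) ⟩
      mulDiff J K (mulVar A F) m - mulDiff J K (mulVar B F) m ≈⟨ mulDiff-⊟ J K (mulVar A F) (mulVar B F) m ⟨
      mulDiff J K (mulDiff A B F) m                           ∎

    mulDiff-⊝ : ∀ J K F → mulDiff J K (⊝ F) ≐ ⊝ mulDiff J K F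
    mulDiff-⊝ J K F m = begin
      mulVar J (⊝ F) m - mulVar K (⊝ F) m  ≈⟨ +-cong (mulVar-⊝ J F m) (-‿cong (mulVar-⊝ K F m)) ⟩
      - mulVar J F m - - mulVar K F m      ≈⟨ solve 2 (λ a b → (:- a) :- (:- b) := :- (a :- b)) ≈-refl _ _ ⟩
      - (mulVar J F m - mulVar K F m)      ∎

    mulDiff-antisym : ∀ J K F → mulDiff J K F ≐ ⊝ mulDiff K J F
    mulDiff-antisym J K F m = solve 2 (λ a b → a :- b := :- (b :- a)) ≈-refl (mulVar J F m) (mulVar K F m)

    mulDiff-split : ∀ A B C F → mulDiff A B F ≐ mulDiff C B F ⊞ mulDiff A C F
    mulDiff-split A B C F m = solve 3 (λ a b c → a :- b := (c :- b) :+ (a :- c)) ≈-refl (mulVar A F m) (mulVar B F m) (mulVar C F m)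

    mulDiff-FreeOf : ∀ {A B J} F → A ≢ J → B ≢ J → FreeOf J F → FreeOf J (mulDiff A B F)
    mulDiff-FreeOf {A} {B} {J} F A≢J B≢J F-free m = begin
      mulVar A F (inc J m) - mulVar B F (inc J m) ≈⟨ +-cong (mulVar-FreeOf F A≢J F-free m) (-‿cong (mulVar-FreeOf F B≢J F-free m)) ⟩
      0# - 0#                                      ≈⟨ -‿inverseʳ 0# ⟩
      0#                                           ∎

    mulDiff-FreeOf⇒𝟘 : ∀ {J K} W → J ≢ K → FreeOf J (mulDiff J K W) → W ≐ 𝟘
    -- Read off at m + e_J, the hypothesis says W m = W (m + e_J - e_K) if t_K divides t^m
    -- and W m = 0 otherwise; descend on the exponent of t_K.
    mulDiff-FreeOf⇒𝟘 {J} {K} W J≢K free m = descend (lookup m K) m refl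
      where
      step : ∀ m → W m ≈ whenPositive (lookup m K) (W (dec K (inc J m)))
      step m = begin
        W m                                                    ≡⟨ mulVar-inc J W m ⟨
        mulVar J W (inc J m)                                   ≈⟨ x∙y⁻¹≈ε⇒x≈y _ _ (free m) ⟩
        mulVar K W (inc J m)                                   ≡⟨ cong (λ k → whenPositive k (W (dec K (inc J m)))) (lookup-inc-≢ (J≢K ∘ ≡.sym) m) ⟩
        whenPositive (lookup m K) (W (dec K (inc J m)))        ∎

      descend : ∀ r m → lookup m K ≡ r → W m ≈ 0#
      descend zero    m m[K]≡0   = ≈-trans (step m) (reflexive (cong (λ k → whenPositive k (W (dec K (inc J m)))) m[K]≡0))
      descend (suc r) m m[K]≡1+r = ≈-trans (step m) (≈-trans
        (reflexive (cong (λ k → whenPositive k (W (dec K (inc J m)))) m[K]≡1+r))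
        (descend r (dec K (inc J m)) (≡.trans (lookup-dec K (inc J m)) (cong ℕ.pred (≡.trans (lookup-inc-≢ (J≢K ∘ ≡.sym) m) m[K]≡1+r)))))

    mulDiff-injective : ∀ {J K} F → J ≢ K → mulDiff J K F ≐ 𝟘 → F ≐ 𝟘
    mulDiff-injective {J} F J≢K DF≐𝟘 = mulDiff-FreeOf⇒𝟘 F J≢K (λ m → DF≐𝟘 (inc J m))

    mulDiff-cancel : ∀ {J K} F G → J ≢ K → mulDiff J K F ≐ mulDiff J K G → F ≐ G
    mulDiff-cancel {J} {K} F G J≢K DF≐DG m = x∙y⁻¹≈ε⇒x≈y _ _ (mulDiff-injective (F ⊟ G) J≢K D[F⊟G]≐𝟘 m)
      where
      D[F⊟G]≐𝟘 : mulDiff J K (F ⊟ G) ≐ 𝟘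
      D[F⊟G]≐𝟘 m = ≈-trans (mulDiff-⊟ J K F G m) (≈-trans (+-congʳ (DF≐DG m)) (-‿inverseʳ _))

    leibniz-j : ∀ J K {G₁ G₂} H → G₁ ⊟ G₂ ≐ mulDiff J K H →
                mulVar J G₁ ⊟ mulVar K G₂ ≐ mulDiff J K (mulVar J H ⊞ G₂)
    leibniz-j J K {G₁} {G₂} H G₁⊟G₂≐DH m = begin
      mulVar J G₁ m - mulVar K G₂ m                              ≈⟨ solve 3 (λ a b c → a :- c := (a :- b) :+ (b :- c)) ≈-refl _ (mulVar J G₂ m) _ ⟩
      (mulVar J G₁ m - mulVar J G₂ m) + mulDiff J K G₂ m         ≈⟨ +-congʳ (mulVar-⊟ J G₁ G₂ m) ⟨
      mulVar J (G₁ ⊟ G₂) m + mulDiff J K G₂ m                    ≈⟨ +-congʳ (≈-trans (mulVar-cong J G₁⊟G₂≐DH m) (mulVar-mulDiff-comm J J K H m)) ⟩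
      mulDiff J K (mulVar J H) m + mulDiff J K G₂ m              ≈⟨ mulDiff-⊞ J K (mulVar J H) G₂ m ⟨
      mulDiff J K (mulVar J H ⊞ G₂) m                            ∎

    leibniz-k : ∀ J K {G₁ G₂} H → G₁ ⊟ G₂ ≐ mulDiff J K H →
                mulVar K G₁ ⊟ mulVar J G₂ ≐ mulDiff J K (mulVar K H ⊟ G₂)
    leibniz-k J K {G₁} {G₂} H G₁⊟G₂≐DH m = begin
      mulVar K G₁ m - mulVar J G₂ m                              ≈⟨ solve 3 (λ a b c → a :- c := (a :- b) :- (c :- b)) ≈-refl _ (mulVar K G₂ m) _ ⟩
      (mulVar K G₁ m - mulVar K G₂ m) - mulDiff J K G₂ m         ≈⟨ +-congʳ (mulVar-⊟ K G₁ G₂ m) ⟨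
      mulVar K (G₁ ⊟ G₂) m - mulDiff J K G₂ m                    ≈⟨ +-congʳ (≈-trans (mulVar-cong K G₁⊟G₂≐DH m) (mulVar-mulDiff-comm K J K H m)) ⟩
      mulDiff J K (mulVar K H) m - mulDiff J K G₂ m              ≈⟨ mulDiff-⊟ J K (mulVar K H) G₂ m ⟨
      mulDiff J K (mulVar K H ⊟ G₂) m                            ∎

    leibniz-fixed : ∀ X J K {G₁ G₂} H → G₁ ⊟ G₂ ≐ mulDiff J K H →
                    mulVar X G₁ ⊟ mulVar X G₂ ≐ mulDiff J K (mulVar X H)
    leibniz-fixed X J K {G₁} {G₂} H G₁⊟G₂≐DH m = begin
      mulVar X G₁ m - mulVar X G₂ m    ≈⟨ mulVar-⊟ X G₁ G₂ m ⟨
      mulVar X (G₁ ⊟ G₂) m             ≈⟨ mulVar-cong X G₁⊟G₂≐DH m ⟩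
      mulVar X (mulDiff J K H) m       ≈⟨ mulVar-mulDiff-comm X J K H m ⟩
      mulDiff J K (mulVar X H) m       ∎

module PolynomialCoefficients {c ℓ} (𝕂 : Field c ℓ) where
  open Field 𝕂 renaming (refl to ≈-refl; sym to ≈-sym; trans to ≈-trans)
  open WithField 𝕂
  open CoefficientCalculus commRing
  open CommutativeRingSolver commRing
  open RingProperties ring using (-1*x≈-x)
  open GroupProperties +-group using (ε⁻¹≈ε)
  open SetoidReasoning setoid

  module _ {n : ℕ} where

    term : Carrier → Mono n → Coeffs n
    term a e m = if does (≡-dec ℕ._≟_ e m) then a else 0#

    coeff-∷ : ∀ a e (p : Poly n) → coeff ((a , e) ∷ p) ≐ term a e ⊞ coeff p
    coeff-∷ a e p m with ≡-dec ℕ._≟_ e m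
    ... | yes _ = ≈-refl
    ... | no _  = ≈-sym (+-identityˡ _)

    coeff-singleton : ∀ a (e : Mono n) → coeff ((a , e) ∷ []) ≐ term a e
    coeff-singleton a e m = ≈-trans (coeff-∷ a e [] m) (+-identityʳ _)

    coeff-++ : ∀ (p q : Poly n) → coeff (p ++ q) ≐ coeff p ⊞ coeff q
    coeff-++ []            q m = ≈-sym (+-identityˡ _)
    coeff-++ ((a , e) ∷ p) q m = begin
      coeff ((a , e) ∷ (p ++ q)) m          ≈⟨ coeff-∷ a e (p ++ q) m ⟩
      term a e m + coeff (p ++ q) m         ≈⟨ +-congˡ (coeff-++ p q m) ⟩
      term a e m + (coeff p m + coeff q m)  ≈⟨ +-assoc _ _ _ ⟨
      (term a e m + coeff p m) + coeff q m  ≈⟨ +-congʳ (coeff-∷ a e p m) ⟨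
      coeff ((a , e) ∷ p) m + coeff q m     ∎

    coeff-∷-split : ∀ t (p : Poly n) → coeff (t ∷ p) ≐ coeff (t ∷ []) ⊞ coeff p
    coeff-∷-split t = coeff-++ (t ∷ [])

    term-‿ : ∀ a (e m : Mono n) → term (- a) e m ≈ - term a e m
    term-‿ a e m with ≡-dec ℕ._≟_ e m
    ... | yes _ = ≈-refl
    ... | no _  = ≈-sym ε⁻¹≈ε

    coeff-negP : ∀ (p : Poly n) → coeff (-P p) ≐ ⊝ coeff p
    coeff-negP []            m = ≈-sym ε⁻¹≈ε
    coeff-negP ((a , e) ∷ p) m = begin
      coeff ((- a , e) ∷ -P p) m          ≈⟨ coeff-∷ (- a) e (-P p) m ⟩
      term (- a) e m + coeff (-P p) m     ≈⟨ +-cong (term-‿ a e m) (coeff-negP p m) ⟩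
      - term a e m + - coeff p m          ≈⟨ solve 2 (λ x y → :- x :+ :- y := :- (x :+ y)) ≈-refl _ _ ⟩
      - (term a e m + coeff p m)          ≈⟨ -‿cong (coeff-∷ a e p m) ⟨
      - coeff ((a , e) ∷ p) m             ∎

    term-* : ∀ a b (e m : Mono n) → term (a * b) e m ≈ a * term b e m
    term-* a b e m with ≡-dec ℕ._≟_ e m
    ... | yes _ = ≈-refl
    ... | no _  = ≈-sym (zeroʳ a)

    term-inc-inc : ∀ a x (e m : Mono n) → term a (inc x e) (inc x m) ≡ term a e m
    term-inc-inc a x e m with ≡-dec ℕ._≟_ (inc x e) (inc x m) | ≡-dec ℕ._≟_ e m
    ... | yes _  | yes _  = refl
    ... | no _   | no _   = refl
    ... | yes xe≡xm | no e≢m = ⊥-elim (e≢m (≡.trans (≡.sym (dec-inc x e)) (≡.trans (cong (dec x) xe≡xm) (dec-inc x m))))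
    ... | no xe≢xm | yes e≡m = ⊥-elim (xe≢xm (cong (inc x) e≡m))

    term-≢ : ∀ a (e m : Mono n) → e ≢ m → term a e m ≡ 0#
    term-≢ a e m e≢m rewrite dec-false (≡-dec ℕ._≟_ e m) e≢m = refl

    inc-≢-at-0 : ∀ x (e m : Mono n) → lookup m x ≡ 0 → inc x e ≢ m
    inc-≢-at-0 x e m m[x]≡0 xe≡m = 1+n≢0 (≡.trans (≡.sym (lookup-inc x e)) (≡.trans (cong (λ v → lookup v x) xe≡m) m[x]≡0))

    mulVar-term : ∀ x a (d : Mono n) → mulVar x (term a d) ≐ term a (inc x d)
    mulVar-term x a d m with lookup m x in m[x]≡
    ... | zero  = reflexive (≡.sym (term-≢ a (inc x d) m (inc-≢-at-0 x d m m[x]≡)))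
    ... | suc _ = reflexive (≡.trans (≡.sym (term-inc-inc a x d (dec x m))) (cong (term a (inc x d)) (inc-dec x m m[x]≡)))

    shifted : Carrier → Fin n → Poly n → Poly n
    shifted a x = List.map (λ t → (a * proj₁ t , inc x (proj₂ t)))

    coeff-shifted-inc : ∀ a x (q : Poly n) m → coeff (shifted a x q) (inc x m) ≈ a * coeff q m
    coeff-shifted-inc a x []            m = ≈-sym (zeroʳ a)
    coeff-shifted-inc a x ((b , e) ∷ q) m = begin
      coeff ((a * b , inc x e) ∷ shifted a x q) (inc x m)                   ≈⟨ coeff-∷ (a * b) (inc x e) (shifted a x q) (inc x m) ⟩
      term (a * b) (inc x e) (inc x m) + coeff (shifted a x q) (inc x m)    ≈⟨ +-cong (reflexive (term-inc-inc (a * b) x e m)) (coeff-shifted-inc a x q m) ⟩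
      term (a * b) e m + a * coeff q m                                      ≈⟨ +-congʳ (term-* a b e m) ⟩
      a * term b e m + a * coeff q m                                        ≈⟨ distribˡ a _ _ ⟨
      a * (term b e m + coeff q m)                                          ≈⟨ *-congˡ (coeff-∷ b e q m) ⟨
      a * coeff ((b , e) ∷ q) m                                             ∎

    coeff-shifted-at-0 : ∀ a x (q : Poly n) m → lookup m x ≡ 0 → coeff (shifted a x q) m ≈ 0#
    coeff-shifted-at-0 a x []            m m[x]≡0 = ≈-refl
    coeff-shifted-at-0 a x ((b , e) ∷ q) m m[x]≡0 = begin
      coeff ((a * b , inc x e) ∷ shifted a x q) m             ≈⟨ coeff-∷ (a * b) (inc x e) (shifted a x q) m ⟩
      term (a * b) (inc x e) m + coeff (shifted a x q) m      ≈⟨ +-cong (reflexive (term-≢ (a * b) (inc x e) m (inc-≢-at-0 x e m m[x]≡0))) (coeff-shifted-at-0 a x q m m[x]≡0) ⟩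
      0# + 0#                                                 ≈⟨ +-identityˡ 0# ⟩
      0#                                                      ∎

    coeff-shifted : ∀ a x (q : Poly n) m → coeff (shifted a x q) m ≈ a * mulVar x (coeff q) m
    coeff-shifted a x q m with lookup m x in m[x]≡
    ... | zero  = ≈-trans (coeff-shifted-at-0 a x q m m[x]≡) (≈-sym (zeroʳ a))
    ... | suc _ = ≈-trans (reflexive (cong (coeff (shifted a x q)) (≡.sym (inc-dec x m m[x]≡)))) (coeff-shifted-inc a x q (dec x m))

    var-*P : ∀ x (q : Poly n) → var x *P q ≡ shifted 1# x q ++ []
    var-*P x q = cong (_++ []) (ListProperties.map-cong (λ { (b , e) → cong (1# * b ,_) (zipWith-+-unitExponent x e) }) q)

    var-P-var-*P : ∀ J K (q : Poly n) → (var J -P var K) *P q ≡ shifted 1# J q ++ (shifted (- 1#) K q ++ [])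
    var-P-var-*P J K q = ≡.cong₂ _++_
      (ListProperties.map-cong (λ { (b , e) → cong (1# * b ,_) (zipWith-+-unitExponent J e) }) q)
      (cong (_++ []) (ListProperties.map-cong (λ { (b , e) → cong (- 1# * b ,_) (zipWith-+-unitExponent K e) }) q))

    coeff-var-*P : ∀ x (q : Poly n) → coeff (var x *P q) ≐ mulVar x (coeff q)
    coeff-var-*P x q m = begin
      coeff (var x *P q) m                ≡⟨ cong (λ p → coeff p m) (var-*P x q) ⟩
      coeff (shifted 1# x q ++ []) m      ≈⟨ coeff-++ (shifted 1# x q) [] m ⟩
      coeff (shifted 1# x q) m + 0#       ≈⟨ +-identityʳ _ ⟩
      coeff (shifted 1# x q) m            ≈⟨ coeff-shifted 1# x q m ⟩
      1# * mulVar x (coeff q) m           ≈⟨ *-identityˡ _ ⟩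
      mulVar x (coeff q) m                ∎

    coeff-var-P-var-*P : ∀ J K (q : Poly n) → coeff ((var J -P var K) *P q) ≐ mulDiff J K (coeff q)
    coeff-var-P-var-*P J K q m = begin
      coeff ((var J -P var K) *P q) m                                       ≡⟨ cong (λ p → coeff p m) (var-P-var-*P J K q) ⟩
      coeff (shifted 1# J q ++ (shifted (- 1#) K q ++ [])) m               ≈⟨ coeff-++ (shifted 1# J q) _ m ⟩
      coeff (shifted 1# J q) m + coeff (shifted (- 1#) K q ++ []) m        ≈⟨ +-congˡ (coeff-++ (shifted (- 1#) K q) [] m) ⟩
      coeff (shifted 1# J q) m + (coeff (shifted (- 1#) K q) m + 0#)       ≈⟨ +-cong (coeff-shifted 1# J q m) (+-congʳ (coeff-shifted (- 1#) K q m)) ⟩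
      1# * mulVar J (coeff q) m + (- 1# * mulVar K (coeff q) m + 0#)       ≈⟨ +-cong (*-identityˡ _) (≈-trans (+-identityʳ _) (-1*x≈-x _)) ⟩
      mulDiff J K (coeff q) m                                               ∎

  -- Division by t_J - t_K, one monomial at a time: modulo t_J - t_K, a t^e is congruent
  -- to a t^(transfer r e), where r is the exponent of t_J in e and transfer moves all r
  -- factors t_J onto t_K; telescope r a e is the corresponding quotient.
  module Division {n : ℕ} (J K : Fin n) where

    transfer : ℕ → Mono n → Mono n
    transfer zero    e = e
    transfer (suc r) e = transfer r (inc K (dec J e))

    telescope : ℕ → Carrier → Mono n → Poly n
    telescope zero    a e = []
    telescope (suc r) a e = (a , dec J e) ∷ telescope r a (inc K (dec J e))

    rem quo : Poly n → Poly n
    rem = List.map (λ t → (proj₁ t , transfer (lookup (proj₂ t) J) (proj₂ t)))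
    quo = List.concatMap (λ t → telescope (lookup (proj₂ t) J) (proj₁ t) (proj₂ t))

    module _ (J≢K : J ≢ K) where

      lookup-transfer : ∀ r e → lookup e J ≡ r → lookup (transfer r e) J ≡ 0
      lookup-transfer zero    e e[J]≡0   = e[J]≡0
      lookup-transfer (suc r) e e[J]≡1+r = lookup-transfer r (inc K (dec J e))
        (≡.trans (lookup-inc-≢ J≢K (dec J e)) (≡.trans (lookup-dec J e) (cong ℕ.pred e[J]≡1+r)))

      monomial-step : ∀ a d → coeff ((a , inc J d) ∷ []) ≐ coeff ((a , inc K d) ∷ []) ⊞ mulDiff J K (coeff ((a , d) ∷ []))
      monomial-step a d m = begin
        coeff ((a , inc J d) ∷ []) m                         ≈⟨ coeff-singleton a (inc J d) m ⟩
        term a (inc J d) m                                   ≈⟨ solve 2 (λ x y → x := y :+ (x :- y)) ≈-refl _ (term a (inc K d) m) ⟩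
        term a (inc K d) m + (term a (inc J d) m - term a (inc K d) m)
          ≈⟨ +-cong (coeff-singleton a (inc K d) m) (+-cong (mulVar-term J a d m) (-‿cong (mulVar-term K a d m))) ⟨
        coeff ((a , inc K d) ∷ []) m + mulDiff J K (term a d) m
          ≈⟨ +-congˡ (mulDiff-cong J K (coeff-singleton a d) m) ⟨
        coeff ((a , inc K d) ∷ []) m + mulDiff J K (coeff ((a , d) ∷ [])) m ∎

      monomial-division : ∀ r a e → lookup e J ≡ r →
        coeff ((a , e) ∷ []) ≐ coeff ((a , transfer r e) ∷ []) ⊞ mulDiff J K (coeff (telescope r a e))
      monomial-division zero    a e _ m = ≈-sym (≈-trans (+-congˡ (mulDiff-𝟘 J K m)) (+-identityʳ _))
      monomial-division (suc r) a e e[J]≡1+r m = begin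
        coeff ((a , e) ∷ []) m                                        ≡⟨ cong (λ e → coeff ((a , e) ∷ []) m) (inc-dec J e e[J]≡1+r) ⟨
        coeff ((a , inc J d) ∷ []) m                                  ≈⟨ monomial-step a d m ⟩
        coeff ((a , e′) ∷ []) m + Dd                                  ≈⟨ +-congʳ (monomial-division r a e′ e′[J]≡r m) ⟩
        (coeff ((a , transfer r e′) ∷ []) m + DT) + Dd                ≈⟨ solve 3 (λ x y z → (x :+ y) :+ z := x :+ (z :+ y)) ≈-refl _ DT Dd ⟩
        coeff ((a , transfer r e′) ∷ []) m + (Dd + DT)                ≈⟨ +-congˡ (mulDiff-⊞ J K (coeff ((a , d) ∷ [])) (coeff T) m) ⟨
        coeff ((a , transfer r e′) ∷ []) m + mulDiff J K (coeff ((a , d) ∷ []) ⊞ coeff T) m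
          ≈⟨ +-congˡ (mulDiff-cong J K (coeff-∷-split (a , d) T) m) ⟨
        coeff ((a , transfer r e′) ∷ []) m + mulDiff J K (coeff ((a , d) ∷ T)) m ∎
        where
        d = dec J e
        e′ = inc K d
        T = telescope r a e′
        Dd = mulDiff J K (coeff ((a , d) ∷ [])) m
        DT = mulDiff J K (coeff T) m
        e′[J]≡r : lookup e′ J ≡ r
        e′[J]≡r = ≡.trans (lookup-inc-≢ J≢K d) (≡.trans (lookup-dec J e) (cong ℕ.pred e[J]≡1+r))

      rem-FreeOf : ∀ P → FreeOf J (coeff (rem P))
      rem-FreeOf []            m = ≈-refl
      rem-FreeOf ((a , e) ∷ P) m = begin
        coeff ((a , e′) ∷ rem P) (inc J m)                  ≈⟨ coeff-∷ a e′ (rem P) (inc J m) ⟩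
        term a e′ (inc J m) + coeff (rem P) (inc J m)       ≈⟨ +-cong (reflexive (term-≢ a e′ (inc J m) e′≢Jm)) (rem-FreeOf P m) ⟩
        0# + 0#                                             ≈⟨ +-identityˡ 0# ⟩
        0#                                                  ∎
        where
        e′ = transfer (lookup e J) e
        e′≢Jm : e′ ≢ inc J m
        e′≢Jm e′≡Jm = inc-≢-at-0 J m e′ (lookup-transfer (lookup e J) e refl) (≡.sym e′≡Jm)

      division : ∀ P → coeff P ≐ coeff (rem P) ⊞ mulDiff J K (coeff (quo P))
      division []            m = ≈-sym (≈-trans (+-congˡ (mulDiff-𝟘 J K m)) (+-identityʳ _))
      division ((a , e) ∷ P) m = begin
        coeff ((a , e) ∷ P) m                                        ≈⟨ coeff-∷-split (a , e) P m ⟩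
        coeff ((a , e) ∷ []) m + coeff P m                           ≈⟨ +-cong (monomial-division (lookup e J) a e refl m) (division P m) ⟩
        (coeff ((a , e′) ∷ []) m + DT) + (coeff (rem P) m + DQ)      ≈⟨ solve 4 (λ x y z w → (x :+ y) :+ (z :+ w) := (x :+ z) :+ (y :+ w)) ≈-refl _ DT _ DQ ⟩
        (coeff ((a , e′) ∷ []) m + coeff (rem P) m) + (DT + DQ)      ≈⟨ +-cong (coeff-∷-split (a , e′) (rem P) m) (mulDiff-⊞ J K (coeff T) (coeff (quo P)) m) ⟨
        coeff ((a , e′) ∷ rem P) m + mulDiff J K (coeff T ⊞ coeff (quo P)) m
          ≈⟨ +-congˡ (mulDiff-cong J K (coeff-++ T (quo P)) m) ⟨
        coeff ((a , e′) ∷ rem P) m + mulDiff J K (coeff (T ++ quo P)) m ∎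
        where
        e′ = transfer (lookup e J) e
        T = telescope (lookup e J) a e
        DT = mulDiff J K (coeff T) m
        DQ = mulDiff J K (coeff (quo P)) m

      -- The remainder R of P is free of t_J, hence so is (t_A - t_B) R, which is also a
      -- multiple of t_J - t_K; such a multiple vanishes, so R = 0.
      coprime-quotient : ∀ {A B} P W → A ≢ B → A ≢ J → B ≢ J →
        mulDiff A B (coeff P) ≐ mulDiff J K W → coeff P ≐ mulDiff J K (coeff (quo P))
      coprime-quotient {A} {B} P W A≢B A≢J B≢J DP≐DW m = begin
        coeff P m                  ≈⟨ division P m ⟩
        R m + mulDiff J K Q m      ≈⟨ +-congʳ (R≐𝟘 m) ⟩
        0# + mulDiff J K Q m       ≈⟨ +-identityˡ _ ⟩
        mulDiff J K Q m            ∎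
        where
        R = coeff (rem P)
        Q = coeff (quo P)
        R≐P⊟DQ : R ≐ coeff P ⊟ mulDiff J K Q
        R≐P⊟DQ m = ≈-trans (solve 2 (λ x y → x := (x :+ y) :- y) ≈-refl (R m) (mulDiff J K Q m)) (+-congʳ (≈-sym (division P m)))
        D[R]≐D[W⊟DQ] : mulDiff A B R ≐ mulDiff J K (W ⊟ mulDiff A B Q)
        D[R]≐D[W⊟DQ] m = begin
          mulDiff A B R m                                        ≈⟨ mulDiff-cong A B R≐P⊟DQ m ⟩
          mulDiff A B (coeff P ⊟ mulDiff J K Q) m                ≈⟨ mulDiff-⊟ A B (coeff P) (mulDiff J K Q) m ⟩
          mulDiff A B (coeff P) m - mulDiff A B (mulDiff J K Q) m ≈⟨ +-cong (DP≐DW m) (-‿cong (mulDiff-comm A B J K Q m)) ⟩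
          mulDiff J K W m - mulDiff J K (mulDiff A B Q) m        ≈⟨ mulDiff-⊟ J K W (mulDiff A B Q) m ⟨
          mulDiff J K (W ⊟ mulDiff A B Q) m                      ∎
        W⊟DQ≐𝟘 : W ⊟ mulDiff A B Q ≐ 𝟘
        W⊟DQ≐𝟘 = mulDiff-FreeOf⇒𝟘 _ J≢K (λ m → ≈-trans (≈-sym (D[R]≐D[W⊟DQ] (inc J m))) (mulDiff-FreeOf R A≢J B≢J (rem-FreeOf P) m))
        R≐𝟘 : R ≐ 𝟘
        R≐𝟘 = mulDiff-injective R A≢B (λ m → ≈-trans (D[R]≐D[W⊟DQ] m) (≈-trans (mulDiff-cong J K W⊟DQ≐𝟘 m) (mulDiff-𝟘 J K m)))

module DividedDifferences {c ℓ} (𝕂 : Field c ℓ) where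
  open Field 𝕂 renaming (refl to ≈-refl; sym to ≈-sym; trans to ≈-trans)
  open WithField 𝕂
  open CoefficientCalculus commRing
  open PolynomialCoefficients 𝕂
  open CommutativeRingSolver commRing
  open GroupProperties +-group using (x∙y⁻¹≈ε⇒x≈y; x≈y⇒x∙y⁻¹≈ε)
  open SetoidReasoning setoid

  module _ {n : ℕ} where

    ⟪_⟫ : H n → Table n → Coeffs n
    ⟪ f ⟫ v = coeff (f v)

    negH : H n → H n
    negH f v = -P f v

    record IsQuotient (j k : Fin n) (f g : H n) : Set ℓ where
      constructor isQuotient
      field
        at : ∀ v → IsPerm v → ⟪ f ⟫ v ⊟ ⟪ f ⟫ (v ∘T transpT j k) ≐ mulDiff (lookup v j) (lookup v k) (⟪ g ⟫ v)

    open IsQuotient public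

    coeff-subH : ∀ (f f′ : H n) v → coeff ((f -H f′) v) ≐ ⟪ f ⟫ v ⊟ ⟪ f′ ⟫ v
    coeff-subH f f′ v m = ≈-trans (coeff-++ (f v) (-P f′ v) m) (+-congˡ (coeff-negP (f′ v) m))

    ≈H⇒IsQuotient : ∀ j k f g → (f -H (f ⋆[ j , k ])) ≈H ((x j -H x k) *H g) → IsQuotient j k f g
    ≈H⇒IsQuotient j k f g eq = isQuotient λ v v-perm m → begin
      (⟪ f ⟫ v ⊟ ⟪ f ⟫ (v ∘T transpT j k)) m                ≈⟨ coeff-subH f (f ⋆[ j , k ]) v m ⟨
      coeff ((f -H (f ⋆[ j , k ])) v) m                     ≈⟨ eq v v-perm m ⟩
      coeff ((var (lookup v j) -P var (lookup v k)) *P g v) m ≈⟨ coeff-var-P-var-*P (lookup v j) (lookup v k) (g v) m ⟩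
      mulDiff (lookup v j) (lookup v k) (⟪ g ⟫ v) m           ∎

    cond : ∀ {j k} f g → IsQuotient j k f g → Cond j k f
    cond {j} {k} f g q = g , λ v v-perm m → begin
      coeff ((f -H (f ⋆[ j , k ])) v) m                     ≈⟨ coeff-subH f (f ⋆[ j , k ]) v m ⟩
      (⟪ f ⟫ v ⊟ ⟪ f ⟫ (v ∘T transpT j k)) m                ≈⟨ at q v v-perm m ⟩
      mulDiff (lookup v j) (lookup v k) (⟪ g ⟫ v) m           ≈⟨ coeff-var-P-var-*P (lookup v j) (lookup v k) (g v) m ⟨
      coeff ((var (lookup v j) -P var (lookup v k)) *P g v) m ∎

    quotient : ∀ {j k} f (c : Cond j k f) → IsQuotient j k f (proj₁ c)
    quotient {j} {k} f (g , eq) = ≈H⇒IsQuotient j k f g eq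

    at-relabel : ∀ {j k f g} → IsQuotient j k f g → ∀ w → IsPerm w → ∀ {A B} →
      lookup w j ≡ A → lookup w k ≡ B → ⟪ f ⟫ w ⊟ ⟪ f ⟫ (w ∘T transpT j k) ≐ mulDiff A B (⟪ g ⟫ w)
    at-relabel q w w-perm refl refl = at q w w-perm

    quotient-unique : ∀ {j k f g g′} → j ≢ k → IsQuotient j k f g → IsQuotient j k f g′ → g ≈H g′
    quotient-unique j≢k q q′ v v-perm =
      mulDiff-cancel _ _ (IsPerm-≢ v v-perm j≢k) (λ m → ≈-trans (≈-sym (at q v v-perm m)) (at q′ v v-perm m))

    quotient-invariant : ∀ {j k f g} → j ≢ k → IsQuotient j k f g → (g ⋆[ j , k ]) ≈H g
    quotient-invariant {j} {k} {f} {g} j≢k q v v-perm =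
      mulDiff-cancel _ _ (IsPerm-≢ v v-perm j≢k) λ m → begin
        mulDiff (lookup v j) (lookup v k) (⟪ g ⟫ w) m  ≈⟨ mulDiff-antisym _ _ (⟪ g ⟫ w) m ⟩
        - mulDiff (lookup v k) (lookup v j) (⟪ g ⟫ w) m ≈⟨ -‿cong (q-at-w m) ⟨
        - (⟪ f ⟫ w m - ⟪ f ⟫ (w ∘T transpT j k) m)      ≡⟨ cong (λ u → - (⟪ f ⟫ w m - ⟪ f ⟫ u m)) (∘transpT-involutive v j k) ⟩
        - (⟪ f ⟫ w m - ⟪ f ⟫ v m)                       ≈⟨ solve 2 (λ a b → :- (a :- b) := b :- a) ≈-refl _ _ ⟩
        ⟪ f ⟫ v m - ⟪ f ⟫ w m                           ≈⟨ at q v v-perm m ⟩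
        mulDiff (lookup v j) (lookup v k) (⟪ g ⟫ v) m  ∎
      where
      w = v ∘T transpT j k
      q-at-w = at-relabel q w (IsPerm-∘transpT v j k v-perm) (lookup-∘transpT-j v j k) (lookup-∘transpT-k v j k)

    quotient-zero⇔invariant : ∀ {j k f g} → j ≢ k → IsQuotient j k f g → (g ≈H 0H ⇔ (f ⋆[ j , k ]) ≈H f)
    quotient-zero⇔invariant {j} {k} {f} {g} j≢k q = mk⇔ g≈0⇒invariant invariant⇒g≈0
      where
      g≈0⇒invariant : g ≈H 0H → (f ⋆[ j , k ]) ≈H f
      g≈0⇒invariant g≈0 v v-perm m = ≈-sym (x∙y⁻¹≈ε⇒x≈y _ _
        (≈-trans (at q v v-perm m) (≈-trans (mulDiff-cong _ _ (g≈0 v v-perm) m) (mulDiff-𝟘 _ _ m))))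

      invariant⇒g≈0 : (f ⋆[ j , k ]) ≈H f → g ≈H 0H
      invariant⇒g≈0 fτ≈f v v-perm = mulDiff-injective _ (IsPerm-≢ v v-perm j≢k)
        (λ m → ≈-trans (≈-sym (at q v v-perm m)) (x≈y⇒x∙y⁻¹≈ε (≈-sym (fτ≈f v v-perm m))))

    quotient-swap : ∀ {j k f g} → IsQuotient j k f g → IsQuotient k j f (negH g)
    quotient-swap {j} {k} {f} {g} q = isQuotient λ v v-perm m → begin
      ⟪ f ⟫ v m - ⟪ f ⟫ (v ∘T transpT k j) m             ≡⟨ cong (λ u → ⟪ f ⟫ v m - ⟪ f ⟫ u m) (∘transpT-comm v k j) ⟩
      ⟪ f ⟫ v m - ⟪ f ⟫ (v ∘T transpT j k) m             ≈⟨ at q v v-perm m ⟩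
      mulDiff (lookup v j) (lookup v k) (⟪ g ⟫ v) m      ≈⟨ mulDiff-antisym _ _ (⟪ g ⟫ v) m ⟩
      - mulDiff (lookup v k) (lookup v j) (⟪ g ⟫ v) m    ≈⟨ mulDiff-⊝ _ _ (⟪ g ⟫ v) m ⟨
      mulDiff (lookup v k) (lookup v j) (⊝ ⟪ g ⟫ v) m    ≈⟨ mulDiff-cong _ _ (coeff-negP (g v)) m ⟨
      mulDiff (lookup v k) (lookup v j) (⟪ negH g ⟫ v) m ∎

    Cond-sym : ∀ {j k} f → Cond k j f → Cond j k f
    Cond-sym {j} {k} f c = cond f (negH (proj₁ c)) (quotient-swap (quotient {k} {j} f c))

    Cond-negH : ∀ {j k} f → Cond j k (negH f) → Cond j k f
    Cond-negH {j} {k} f c = cond f (negH g) (isQuotient λ v v-perm m → begin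
      ⟪ f ⟫ v m - ⟪ f ⟫ (v ∘T transpT j k) m                    ≈⟨ solve 2 (λ a b → a :- b := :- ((:- a) :- (:- b))) ≈-refl _ _ ⟩
      - (- ⟪ f ⟫ v m - - ⟪ f ⟫ (v ∘T transpT j k) m)            ≈⟨ -‿cong (+-cong (coeff-negP (f v) m) (-‿cong (coeff-negP (f (v ∘T transpT j k)) m))) ⟨
      - (⟪ negH f ⟫ v m - ⟪ negH f ⟫ (v ∘T transpT j k) m)      ≈⟨ -‿cong (at (quotient {j} {k} (negH f) c) v v-perm m) ⟩
      - mulDiff (lookup v j) (lookup v k) (⟪ g ⟫ v) m           ≈⟨ mulDiff-⊝ _ _ (⟪ g ⟫ v) m ⟨
      mulDiff (lookup v j) (lookup v k) (⊝ ⟪ g ⟫ v) m           ≈⟨ mulDiff-cong _ _ (coeff-negP (g v)) m ⟨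
      mulDiff (lookup v j) (lookup v k) (⟪ negH g ⟫ v) m        ∎)
      where g = proj₁ c

    Cond-invariant : ∀ {j k} f → (f ⋆[ j , k ]) ≈H f → Cond j k f
    Cond-invariant f fτ≈f = cond f 0H (isQuotient λ v v-perm m →
      ≈-trans (x≈y⇒x∙y⁻¹≈ε (≈-sym (fτ≈f v v-perm m))) (≈-sym (mulDiff-𝟘 _ _ m)))

    quotientH : Fin n → Fin n → H n → H n
    quotientH j k g v = Division.quo (lookup v j) (lookup v k) ((g -H (g ⋆[ j , k ])) v)

    quotientH-exact : ∀ {p q j k} g (W : Table n → Coeffs n) → p ≢ q → p ≢ j → q ≢ j → j ≢ k →
      (∀ v → IsPerm v → mulDiff (lookup v p) (lookup v q) (⟪ g ⟫ v ⊟ ⟪ g ⟫ (v ∘T transpT j k))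
                          ≐ mulDiff (lookup v j) (lookup v k) (W v)) →
      IsQuotient j k g (quotientH j k g)
    quotientH-exact {p} {q} {j} {k} g W p≢q p≢j q≢j j≢k D[g⊟gτ]≐DW = isQuotient λ v v-perm m →
      let P = (g -H (g ⋆[ j , k ])) v
          P≐ = coeff-subH g (g ⋆[ j , k ]) v
          ≢ = IsPerm-≢ v v-perm
      in ≈-trans (≈-sym (P≐ m))
           (Division.coprime-quotient _ _ (≢ j≢k) P (W v) (≢ p≢q) (≢ p≢j) (≢ q≢j)
             (λ m → ≈-trans (mulDiff-cong _ _ P≐ m) (D[g⊟gτ]≐DW v v-perm m)) m)

    Cond-quotient-disjoint : ∀ {p q j k} f {g h} → p ≢ q → j ≢ k → j ≢ p → j ≢ q → k ≢ p → k ≢ q →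
      IsQuotient p q f g → IsQuotient j k f h → Cond j k g
    Cond-quotient-disjoint {p} {q} {j} {k} f {g} {h} p≢q j≢k j≢p j≢q k≢p k≢q qs qτ =
      cond g (quotientH j k g) (quotientH-exact g W p≢q (j≢p ∘ ≡.sym) (j≢q ∘ ≡.sym) j≢k square)
      where
      W : Table n → Coeffs n
      W v = ⟪ h ⟫ v ⊟ ⟪ h ⟫ (v ∘T transpT p q)

      square : ∀ v → IsPerm v → mulDiff (lookup v p) (lookup v q) (⟪ g ⟫ v ⊟ ⟪ g ⟫ (v ∘T transpT j k))
                                 ≐ mulDiff (lookup v j) (lookup v k) (W v)
      square v v-perm m = begin
        X (G₁ ⊟ G₂) m                 ≈⟨ mulDiff-⊟ _ _ G₁ G₂ m ⟩
        X G₁ m - X G₂ m               ≈⟨ +-cong (at qs v v-perm m) (-‿cong E₂) ⟨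
        (a₁ - a₂) - (a₃ - a₄)         ≈⟨ solve 4 (λ a b c d → (a :- b) :- (c :- d) := (a :- c) :- (b :- d)) ≈-refl a₁ a₂ a₃ a₄ ⟩
        (a₁ - a₃) - (a₂ - a₄)         ≈⟨ +-cong (at qτ v v-perm m) (-‿cong E₄) ⟩
        Z (⟪ h ⟫ v) m - Z (⟪ h ⟫ vs) m ≈⟨ mulDiff-⊟ _ _ (⟪ h ⟫ v) (⟪ h ⟫ vs) m ⟨
        Z (W v) m                     ∎
        where
        vs = v ∘T transpT p q
        vτ = v ∘T transpT j k
        X = mulDiff (lookup v p) (lookup v q)
        Z = mulDiff (lookup v j) (lookup v k)
        G₁ = ⟪ g ⟫ v
        G₂ = ⟪ g ⟫ vτ
        a₁ = ⟪ f ⟫ v m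
        a₂ = ⟪ f ⟫ vs m
        a₃ = ⟪ f ⟫ vτ m
        a₄ = ⟪ f ⟫ (vτ ∘T transpT p q) m
        E₂ : a₃ - a₄ ≈ X G₂ m
        E₂ = at-relabel qs vτ (IsPerm-∘transpT v j k v-perm)
               (lookup-∘transpT-fixed v (j≢p ∘ ≡.sym) (k≢p ∘ ≡.sym)) (lookup-∘transpT-fixed v (j≢q ∘ ≡.sym) (k≢q ∘ ≡.sym)) m
        E₄ : a₂ - a₄ ≈ Z (⟪ h ⟫ vs) m
        E₄ = ≈-trans (+-congˡ (-‿cong (reflexive (cong (λ u → ⟪ f ⟫ u m) (≡.sym (∘transpT-comm-disjoint v j≢p j≢q k≢p k≢q))))))
               (at-relabel qτ vs (IsPerm-∘transpT v p q v-perm)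
                 (lookup-∘transpT-fixed v j≢p j≢q) (lookup-∘transpT-fixed v k≢p k≢q) m)

    Cond-quotient-adjacent : ∀ {p q k} f {g h₁ h₂} → p ≢ q → k ≢ p → k ≢ q →
      IsQuotient p q f g → IsQuotient k p f h₁ → IsQuotient k q f h₂ → Cond k p g
    Cond-quotient-adjacent {p} {q} {k} f {g} {h₁} {h₂} p≢q k≢p k≢q qs q₁ q₂ =
      cond g (quotientH k p g) (quotientH-exact g W p≢q (k≢p ∘ ≡.sym) (k≢q ∘ ≡.sym) k≢p square)
      where
      W : Table n → Coeffs n
      W v = ⟪ h₁ ⟫ v ⊟ ⟪ h₂ ⟫ (v ∘T transpT p q) ⊞ ⟪ g ⟫ (v ∘T transpT k p)

      square : ∀ v → IsPerm v → mulDiff (lookup v p) (lookup v q) (⟪ g ⟫ v ⊟ ⟪ g ⟫ (v ∘T transpT k p))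
                                 ≐ mulDiff (lookup v k) (lookup v p) (W v)
      square v v-perm m = begin
        mulDiff A B (G₁ ⊟ G₂) m                           ≈⟨ mulDiff-⊟ A B G₁ G₂ m ⟩
        mulDiff A B G₁ m - mulDiff A B G₂ m               ≈⟨ +-congˡ (-‿cong (≈-trans (mulDiff-split A B K G₂ m) (+-congˡ (mulDiff-antisym A K G₂ m)))) ⟩
        mulDiff A B G₁ m - (mulDiff K B G₂ m + - Z G₂ m)  ≈⟨ +-cong (at qs v v-perm m) (-‿cong (+-congʳ E₂)) ⟨
        (a₁ - a₂) - ((a₃ - a₄) + - Z G₂ m)                ≈⟨ solve 5 (λ a b c d z → (a :- b) :- ((c :- d) :+ (:- z)) := ((a :- c) :- (b :- d)) :+ z) ≈-refl a₁ a₂ a₃ a₄ (Z G₂ m) ⟩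
        ((a₁ - a₃) - (a₂ - a₄)) + Z G₂ m                  ≈⟨ +-congʳ (+-cong (at q₁ v v-perm m) (-‿cong E₄)) ⟩
        (Z (⟪ h₁ ⟫ v) m - Z (⟪ h₂ ⟫ vs) m) + Z G₂ m       ≈⟨ +-congʳ (mulDiff-⊟ K A (⟪ h₁ ⟫ v) (⟪ h₂ ⟫ vs) m) ⟨
        Z (⟪ h₁ ⟫ v ⊟ ⟪ h₂ ⟫ vs) m + Z G₂ m               ≈⟨ mulDiff-⊞ K A (⟪ h₁ ⟫ v ⊟ ⟪ h₂ ⟫ vs) G₂ m ⟨
        Z (W v) m                                         ∎
        where
        A = lookup v p
        B = lookup v q
        K = lookup v k
        Z = mulDiff K A
        vs = v ∘T transpT p q
        vτ = v ∘T transpT k p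
        G₁ = ⟪ g ⟫ v
        G₂ = ⟪ g ⟫ vτ
        a₁ = ⟪ f ⟫ v m
        a₂ = ⟪ f ⟫ vs m
        a₃ = ⟪ f ⟫ vτ m
        a₄ = ⟪ f ⟫ (vτ ∘T transpT p q) m
        E₂ : a₃ - a₄ ≈ mulDiff K B G₂ m
        E₂ = at-relabel qs vτ (IsPerm-∘transpT v k p v-perm)
               (lookup-∘transpT-k v k p) (lookup-∘transpT-fixed v (k≢q ∘ ≡.sym) (p≢q ∘ ≡.sym)) m
        E₄ : a₂ - a₄ ≈ Z (⟪ h₂ ⟫ vs) m
        E₄ = ≈-trans (+-congˡ (-‿cong (reflexive (cong (λ u → ⟪ f ⟫ u m) (≡.sym (∘transpT-adjacent v k≢p k≢q))))))
               (at-relabel q₂ vs (IsPerm-∘transpT v p q v-perm)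
                 (lookup-∘transpT-fixed v k≢p k≢q) (lookup-∘transpT-k v p q) m)

    coeff-x*H : ∀ a (g : H n) v → ⟪ x a *H g ⟫ v ≐ mulVar (lookup v a) (⟪ g ⟫ v)
    coeff-x*H a g v = coeff-var-*P (lookup v a) (g v)

    x*H-quotient : ∀ a {j k} g w →
      (∀ v → IsPerm v → mulVar (lookup v a) (⟪ g ⟫ v) ⊟ mulVar (lookup (v ∘T transpT j k) a) (⟪ g ⟫ (v ∘T transpT j k))
                          ≐ mulDiff (lookup v j) (lookup v k) (⟪ w ⟫ v)) →
      IsQuotient j k (x a *H g) w
    x*H-quotient a {j} {k} g w eq = isQuotient λ v v-perm m →
      ≈-trans (+-cong (coeff-x*H a g v m) (-‿cong (coeff-x*H a g (v ∘T transpT j k) m))) (eq v v-perm m)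

    x*H-quotient-of-invariant : ∀ {j k} g → (g ⋆[ j , k ]) ≈H g → IsQuotient j k (x j *H g) g
    x*H-quotient-of-invariant {j} {k} g gτ≈g = x*H-quotient j g g λ v v-perm m →
      +-congˡ (-‿cong (≈-trans
        (reflexive (cong (λ K → mulVar K (⟪ g ⟫ (v ∘T transpT j k)) m) (lookup-∘transpT-j v j k)))
        (mulVar-cong (lookup v k) (gτ≈g v v-perm) m)))

    Cond-x*H : ∀ a {j k} g → Cond j k g → Cond j k (x a *H g)
    Cond-x*H a {j} {k} g c with a ≟ j | a ≟ k
    ... | yes refl | _ = cond _ w (x*H-quotient a g w λ v v-perm m →
      let J = lookup v j; K = lookup v k; vτ = v ∘T transpT j k; G₁ = ⟪ g ⟫ v; G₂ = ⟪ g ⟫ vτ in begin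
      mulVar J G₁ m - mulVar (lookup vτ j) G₂ m   ≡⟨ cong (λ K′ → mulVar J G₁ m - mulVar K′ G₂ m) (lookup-∘transpT-j v j k) ⟩
      mulVar J G₁ m - mulVar K G₂ m               ≈⟨ leibniz-j J K (⟪ h ⟫ v) (at q v v-perm) m ⟩
      mulDiff J K (mulVar J (⟪ h ⟫ v) ⊞ G₂) m     ≈⟨ mulDiff-cong J K (λ m → ≈-trans (coeff-++ (var J *P h v) (g vτ) m) (+-congʳ (coeff-var-*P J (h v) m))) m ⟨
      mulDiff J K (⟪ w ⟫ v) m                     ∎)
      where
      h = proj₁ c
      q = quotient g c
      w : H n
      w v = var (lookup v j) *P h v ++ g (v ∘T transpT j k)
    ... | no _ | yes refl = cond _ w (x*H-quotient a g w λ v v-perm m →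
      let J = lookup v j; K = lookup v k; vτ = v ∘T transpT j k; G₁ = ⟪ g ⟫ v; G₂ = ⟪ g ⟫ vτ in begin
      mulVar K G₁ m - mulVar (lookup vτ k) G₂ m   ≡⟨ cong (λ J′ → mulVar K G₁ m - mulVar J′ G₂ m) (lookup-∘transpT-k v j k) ⟩
      mulVar K G₁ m - mulVar J G₂ m               ≈⟨ leibniz-k J K (⟪ h ⟫ v) (at q v v-perm) m ⟩
      mulDiff J K (mulVar K (⟪ h ⟫ v) ⊟ G₂) m     ≈⟨ mulDiff-cong J K (λ m → ≈-trans (coeff-++ (var K *P h v) (-P g vτ) m) (+-cong (coeff-var-*P K (h v) m) (coeff-negP (g vτ) m))) m ⟨
      mulDiff J K (⟪ w ⟫ v) m                     ∎)
      where
      h = proj₁ c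
      q = quotient g c
      w : H n
      w v = var (lookup v k) *P h v ++ -P g (v ∘T transpT j k)
    ... | no a≢j | no a≢k = cond _ w (x*H-quotient a g w λ v v-perm m →
      let X = lookup v a; vτ = v ∘T transpT j k; G₁ = ⟪ g ⟫ v; G₂ = ⟪ g ⟫ vτ in begin
      mulVar X G₁ m - mulVar (lookup vτ a) G₂ m         ≡⟨ cong (λ X′ → mulVar X G₁ m - mulVar X′ G₂ m) (lookup-∘transpT-fixed v a≢j a≢k) ⟩
      mulVar X G₁ m - mulVar X G₂ m                     ≈⟨ leibniz-fixed X _ _ (⟪ h ⟫ v) (at q v v-perm) m ⟩
      mulDiff (lookup v j) (lookup v k) (mulVar X (⟪ h ⟫ v)) m ≈⟨ mulDiff-cong _ _ (coeff-var-*P X (h v)) m ⟨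
      mulDiff (lookup v j) (lookup v k) (⟪ w ⟫ v) m     ∎)
      where
      h = proj₁ c
      q = quotient g c
      w : H n
      w v = var (lookup v a) *P h v

    module _ (C : Fin n → Fin n → Set) (C-irrefl : ∀ j k → C j k → j ≢ k) (C-sym : ∀ j k → C j k → C k j) where

      Cond-quotient-incident : ∀ {p q} → (∀ {k} → k ≢ p → k ≢ q → C p k → C q k) →
        ∀ f {g} → p ≢ q → InH C f → IsQuotient p q f g → ∀ k → C p k → Cond p k g
      Cond-quotient-incident {p} {q} C-pk⇒qk f {g} p≢q f∈H qg k c with k ≟ p | k ≟ q
      ... | yes refl | _        = ⊥-elim (C-irrefl k k c refl)
      ... | no _     | yes refl = Cond-invariant g (quotient-invariant p≢q qg)
      ... | no k≢p   | no k≢q   = Cond-sym g (Cond-quotient-adjacent f p≢q k≢p k≢q qg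
        (quotient f (f∈H k p (C-sym p k c))) (quotient f (f∈H k q (C-sym q k (C-pk⇒qk k≢p k≢q c)))))

      InH-quotient : ∀ {p q} → (∀ j k → C j k ⇔ C (swapFin p q j) (swapFin p q k)) →
        ∀ f {g} → p ≢ q → InH C f → IsQuotient p q f g → InH C g
      InH-quotient {p} {q} C-stable f {g} p≢q f∈H qg = g∈H
        where
        from-p : ∀ k → C p k → Cond p k g
        from-p = Cond-quotient-incident
          (λ k≢p k≢q c → ≡.subst₂ C (swapFin-j p q) (swapFin-fixed k≢p k≢q) (Equivalence.to (C-stable p _) c))
          f p≢q f∈H qg

        from-q : ∀ k → C q k → Cond q k g
        from-q k c = Cond-negH g (Cond-quotient-incident
          (λ k≢q k≢p c → ≡.subst₂ C (swapFin-k p q) (swapFin-fixed k≢p k≢q) (Equivalence.to (C-stable q _) c))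
          f (p≢q ∘ ≡.sym) f∈H (quotient-swap qg) k c)

        g∈H : InH C g
        g∈H j k c with j ≟ p | j ≟ q | k ≟ p | k ≟ q
        ... | yes refl | _        | _        | _        = from-p k c
        ... | no _     | yes refl | _        | _        = from-q k c
        ... | no _     | no _     | yes refl | _        = Cond-sym g (from-p j (C-sym j k c))
        ... | no _     | no _     | no _     | yes refl = Cond-sym g (from-q j (C-sym j k c))
        ... | no j≢p   | no j≢q   | no k≢p   | no k≢q   =
          Cond-quotient-disjoint f p≢q (C-irrefl j k c) j≢p j≢q k≢p k≢q qg (quotient f (f∈H j k c))

corollary5p2 : ∀ {c ℓ} (K : Field c ℓ) → let open WithField K in
    (m : ℕ) (i : Fin m) (C : Fin (suc m) → Fin (suc m) → Set) →
    (∀ j k → C j k → ¬ (j ≡ k)) →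
    (∀ j k → C j k → C k j) →
    (sC : C (inject₁ i) (Fin.suc i)) →
    (∀ j k → C j k ⇔ C (swapFin (inject₁ i) (Fin.suc i) j) (swapFin (inject₁ i) (Fin.suc i) k)) →
    ((f : H (suc m)) (hf : InH C f) →
        InH C (∂ i f (hf (inject₁ i) (Fin.suc i) sC))
      × ((∂ i f (hf (inject₁ i) (Fin.suc i) sC) ⋆[ inject₁ i , Fin.suc i ]) ≈H ∂ i f (hf (inject₁ i) (Fin.suc i) sC))
      × ((∂ i f (hf (inject₁ i) (Fin.suc i) sC) ≈H 0H) ⇔ ((f ⋆[ inject₁ i , Fin.suc i ]) ≈H f)))
    × ((g : H (suc m)) → InH C g → (g ⋆[ inject₁ i , Fin.suc i ]) ≈H g →
        Σ (H (suc m)) (λ f → Σ (InH C f) (λ hf → ∂ i f (hf (inject₁ i) (Fin.suc i) sC) ≈H g)))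
corollary5p2 K m i C C-irrefl C-sym sC C-stable =
  (λ f f∈H → let q = quotient f (f∈H a b sC) in
      InH-quotient C C-irrefl C-sym C-stable f a≢b f∈H q
    , quotient-invariant a≢b q
    , quotient-zero⇔invariant a≢b q) ,
  (λ g g∈H gs≈g → let x·g∈H = λ j k c → Cond-x*H a g (g∈H j k c) in
      x a *H g , x·g∈H , quotient-unique a≢b (quotient (x a *H g) (x·g∈H a b sC)) (x*H-quotient-of-invariant g gs≈g))
  where
  open WithField K
  open DividedDifferences K
  a b : Fin (suc m)
  a = inject₁ i
  b = Fin.suc i
  a≢b : ¬ (a ≡ b)
  a≢b = C-irrefl a b sC
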